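{- Let $(a,b,c)$ be integers with $0<a+1<b<c$ and $P_a+P_c=2P_b$. Let $$A=3(b-c)^2\left(12(b-a)^2(c-b)^2-(a-2b+c)^4\right).$$ Then $A>0$ and $A$ is not the square of an integer.
   Context: For an integer $n$, $P_n=\frac{n(n+1)(2n+1)}{6}$ (the $n$th square pyramidal number for $n\geq 1$). -}

module Defs where

open import Data.Integer.Base using (ℤ; _+_; _-_; _*_; _/ℕ_; _^_; +_)

-- P n = n(n+1)(2n+1)/6, the square pyramidal number (the division is exact for every integer n)
P : ℤ → ℤ
P n = (n * (n + + 1) * (+ 2 * n + + 1)) /ℕ 6

{-# OPTIONS --safe #-}
module Submission where

-- Write x = b − a, y = c − b, d = x − y, u = a + c + 1 and 6Pₙ = n(n+1)(2n+1).
-- Expanding, 2(6P_a + 6P_c − 12P_b) = 12uxy − d(3u² + d² − 1), so the hypothesis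
-- forces d > 0 and dN = 12uxy with N = 3u² + d² − 1. Since A = 36(xy²)² − 3(yd²)²,
-- substituting this gives (2u)²A = (yd)²W with W = N² − 12u²d² = M² − 4d², where
-- M = 3u² − d² − 1. As u > d, we have 0 < 4d² < 2M − 1, so W lies strictly between
-- (M − 1)² and M²: W > 0 is not a square, and therefore A > 0 is not a square either.

open import Level using (Level) renaming (suc to lsuc)
open import Data.Nat.Base using (ℕ)
open import Data.Product using (∃; _×_; _,_)
open import Data.Sum using (inj₁; inj₂)
open import Data.Empty using (⊥-elim)
open import Function using (id)
open import Relation.Nullary using (¬_)
open import Relation.Binary.PropositionalEquality
  using (_≡_; refl; sym; trans; cong; cong₂; subst; subst₂; module ≡-Reasoning)
open ≡-Reasoning

open import Defs

-- The polynomials of the proof and the identities between them are written once over this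
-- signature: over ℕ they are the quantities themselves, over ring-solver syntax the identities
-- are checked by normalisation. Shifted variables (x = 1 + X, ...) keep everything in ℕ
-- free of subtraction.
record Signature ℓ : Set (lsuc ℓ) where
  infixl 6 _⊕_
  infixl 7 _⊗_
  infix  4 _≈_
  field
    Term     : Set
    Equation : Set ℓ
    _⊕_ _⊗_  : Term → Term → Term
    κ        : ℕ → Term
    _≈_      : Term → Term → Equation

module Polynomials {ℓ : Level} (S : Signature ℓ) where
  open Signature S

  infix 8 _²
  _² : Term → Term
  t ² = t ⊗ t

  sixP : Term → Term
  sixP n = n ⊗ (n ⊕ κ 1) ⊗ (κ 2 ⊗ n ⊕ κ 1)

  SixPStep : Term → Equation
  SixPStep n = sixP n ⊕ (κ 1 ⊕ n) ² ⊗ κ 6 ≈ sixP (κ 1 ⊕ n)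

  module GrowingGap (a X z : Term) where
    x y b c U u N : Term
    x = κ 1 ⊕ X
    y = x ⊕ z
    b = a ⊕ x
    c = b ⊕ y
    U = a ⊕ c
    u = κ 1 ⊕ U
    -- N = 3u² + z² − 1
    N = κ 3 ⊗ U ² ⊕ κ 6 ⊗ U ⊕ κ 2 ⊕ z ²

    Balance : Equation
    Balance = κ 2 ⊗ (sixP a ⊕ sixP c)
            ≈ κ 2 ⊗ (κ 2 ⊗ sixP b) ⊕ (κ 12 ⊗ u ⊗ x ⊗ y ⊕ z ⊗ N)

  module ShrinkingGap (a Y D : Term) where
    y d x b c U u N k e m R W An Am : Term
    y = κ 1 ⊕ Y
    d = κ 1 ⊕ D
    x = y ⊕ d
    b = a ⊕ x
    c = b ⊕ y
    U = a ⊕ c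
    u = κ 1 ⊕ U
    -- N = 3u² + d² − 1
    N = κ 3 ⊗ U ² ⊕ κ 6 ⊗ U ⊕ κ 2 ⊕ d ²
    k = a ⊕ y
    -- e = u − d, m = M − 1 = 3u² − d² − 2, R = 2m + 1 − 4d² = 6e² + 12ed − 3
    e = κ 1 ⊕ κ 2 ⊗ k
    m = κ 3 ⊗ e ² ⊕ κ 6 ⊗ e ⊗ d ⊕ κ 2 ⊗ D ² ⊕ κ 4 ⊗ D
    R = κ 3 ⊕ κ 24 ⊗ k ⊗ (κ 1 ⊕ k) ⊕ κ 12 ⊗ e ⊗ d
    W = R ⊕ m ²
    -- A = An − Am
    An = κ 36 ⊗ (x ⊗ y ⊗ y) ²
    Am = κ 3 ⊗ (y ⊗ d ⊗ d) ²

    Balance : Equation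
    Balance = κ 2 ⊗ (sixP a ⊕ sixP c) ⊕ d ⊗ N
            ≈ κ 2 ⊗ (κ 2 ⊗ sixP b) ⊕ κ 12 ⊗ u ⊗ x ⊗ y

    ScaledAn : Equation
    ScaledAn = (κ 2 ⊗ u) ² ⊗ An ≈ (y ⊗ (κ 12 ⊗ u ⊗ x ⊗ y)) ²

    ScaledDN : Equation
    ScaledDN = (y ⊗ (d ⊗ N)) ² ≈ (y ⊗ d) ² ⊗ W ⊕ (κ 2 ⊗ u) ² ⊗ Am

    SquareAboveW : Equation
    SquareAboveW = (κ 1 ⊕ m) ² ≈ W ⊕ κ 4 ⊗ d ²

module Naturals where
  open import Data.Nat.Base
  open import Data.Nat.Properties
  open import Data.Nat.DivMod using (_/_; m/n*n≡m)
  open import Data.Nat.Divisibility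
    using (_∣_; divides; ∣-refl; ∣-trans; m∣m*n; *-cancelʳ-∣)
  open import Data.Nat.GCD using (gcd; gcd[m,n]∣m; gcd[m,n]∣n; gcd[m,n]≢0)
  open import Data.Nat.Coprimality using (coprime-/gcd; coprime-divisor)
    renaming (sym to coprime-sym)
  open import Algebra.Properties.CommutativeSemigroup *-commutativeSemigroup
    using (interchange)
  open import Data.Nat.Solver using (module +-*-Solver)
  open +-*-Solver using (solve; _:=_; con; _:+_; _:*_; Polynomial)

  ℕ-signature : Signature _
  ℕ-signature = record
    { Term = ℕ ; Equation = Set ; _⊕_ = _+_ ; _⊗_ = _*_ ; κ = id ; _≈_ = _≡_ }

  syntax-signature : ℕ → Signature _
  syntax-signature n = record
    { Term = Polynomial n ; Equation = Polynomial n × Polynomial n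
    ; _⊕_ = _:+_ ; _⊗_ = _:*_ ; κ = con ; _≈_ = _:=_ }

  open Polynomials ℕ-signature public
  module Syntax {n : ℕ} = Polynomials (syntax-signature n)

  sixP-step : ∀ n → SixPStep n
  sixP-step = solve 1 Syntax.SixPStep refl

  growing-balance : ∀ a X z → GrowingGap.Balance a X z
  growing-balance = solve 3 Syntax.GrowingGap.Balance refl

  shrinking-balance : ∀ a Y D → ShrinkingGap.Balance a Y D
  shrinking-balance = solve 3 Syntax.ShrinkingGap.Balance refl

  scaled-An : ∀ a Y D → ShrinkingGap.ScaledAn a Y D
  scaled-An = solve 3 Syntax.ShrinkingGap.ScaledAn refl

  scaled-dN : ∀ a Y D → ShrinkingGap.ScaledDN a Y D
  scaled-dN = solve 3 Syntax.ShrinkingGap.ScaledDN refl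

  square-above-W : ∀ a Y D → ShrinkingGap.SquareAboveW a Y D
  square-above-W = solve 3 Syntax.ShrinkingGap.SquareAboveW refl

  sumSquares : ℕ → ℕ
  sumSquares zero    = 0
  sumSquares (suc n) = sumSquares n + suc n * suc n

  sumSquares*6≡sixP : ∀ n → sumSquares n * 6 ≡ sixP n
  sumSquares*6≡sixP zero    = refl
  sumSquares*6≡sixP (suc n) = begin
    (sumSquares n + suc n * suc n) * 6    ≡⟨ *-distribʳ-+ 6 (sumSquares n) (suc n * suc n) ⟩
    sumSquares n * 6 + suc n * suc n * 6  ≡⟨ cong (_+ suc n * suc n * 6)
                                                   (sumSquares*6≡sixP n) ⟩
    sixP n + suc n * suc n * 6            ≡⟨ sixP-step n ⟩
    sixP (suc n)                          ∎

  sumSquares-balanced⇒sixP-balanced :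
    ∀ a b c → sumSquares a + sumSquares c ≡ 2 * sumSquares b → sixP a + sixP c ≡ 2 * sixP b
  sumSquares-balanced⇒sixP-balanced a b c balanced = begin
    sixP a + sixP c                      ≡⟨ cong₂ _+_ (sumSquares*6≡sixP a)
                                                      (sumSquares*6≡sixP c) ⟨
    sumSquares a * 6 + sumSquares c * 6  ≡⟨ *-distribʳ-+ 6 (sumSquares a) (sumSquares c) ⟨
    (sumSquares a + sumSquares c) * 6    ≡⟨ cong (_* 6) balanced ⟩
    2 * sumSquares b * 6                 ≡⟨ *-assoc 2 (sumSquares b) 6 ⟩
    2 * (sumSquares b * 6)               ≡⟨ cong (2 *_) (sumSquares*6≡sixP b) ⟩
    2 * sixP b                           ∎

  m<n⇒∃[o]m+suc[o]≡n : ∀ {m n} → m < n → ∃ λ o → m + suc o ≡ n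
  m<n⇒∃[o]m+suc[o]≡n {m} m<n with m≤n⇒∃[o]m+o≡n m<n
  ... | o , 1+m+o≡n = o , trans (+-suc m o) 1+m+o≡n

  IsSquare : ℕ → Set
  IsSquare n = ∃ λ w → w * w ≡ n

  ¬IsSquare-between : ∀ {m n} → m * m < n → n < suc m * suc m → ¬ IsSquare n
  ¬IsSquare-between {m} m²<n n<[1+m]² (w , refl) with ≤-<-connex w m
  ... | inj₁ w≤m = <⇒≱ m²<n (*-mono-≤ w≤m w≤m)
  ... | inj₂ m<w = <⇒≱ n<[1+m]² (*-mono-≤ m<w m<w)

  n²∣m²⇒n∣m : ∀ m n .{{_ : NonZero n}} → n * n ∣ m * m → n ∣ m
  n²∣m²⇒n∣m m n n²∣m² = subst (_∣ m) (sym n≡g) (gcd[m,n]∣m m n)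
    where
    g : ℕ
    g = gcd m n
    instance
      g≢0 : NonZero g
      g≢0 = ≢-nonZero (gcd[m,n]≢0 m n (inj₂ (≢-nonZero⁻¹ n)))
    m′ n′ : ℕ
    m′ = m / g
    n′ = n / g
    square-split : ∀ {s} t → t * g ≡ s → s * s ≡ t * t * (g * g)
    square-split t refl = interchange t g t g
    n′²∣m′² : n′ * n′ ∣ m′ * m′
    n′²∣m′² = *-cancelʳ-∣ (g * g) {{m*n≢0 g g}}
      (subst₂ _∣_ (square-split n′ (m/n*n≡m (gcd[m,n]∣n m n)))
                  (square-split m′ (m/n*n≡m (gcd[m,n]∣m m n))) n²∣m²)
    n′≡1 : n′ ≡ 1
    n′≡1 = coprime-/gcd m n
      ( coprime-divisor (coprime-sym (coprime-/gcd m n)) (∣-trans (m∣m*n n′) n′²∣m′²)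
      , ∣-refl )
    n≡g : n ≡ g
    n≡g = begin
      n       ≡⟨ m/n*n≡m (gcd[m,n]∣n m n) ⟨
      n′ * g  ≡⟨ cong (_* g) n′≡1 ⟩
      1 * g   ≡⟨ *-identityˡ g ⟩
      g       ∎

  IsSquare-cancelˡ : ∀ n k .{{_ : NonZero n}} → IsSquare (n * n * k) → IsSquare k
  IsSquare-cancelˡ n k (m , m²≡n²k)
    with n²∣m²⇒n∣m m n (divides k (trans m²≡n²k (*-comm (n * n) k)))
  ... | divides q refl = q , *-cancelʳ-≡ (q * q) k (n * n) {{m*n≢0 n n}} (begin
    q * q * (n * n)  ≡⟨ interchange q n q n ⟨
    q * n * (q * n)  ≡⟨ m²≡n²k ⟩
    n * n * k        ≡⟨ *-comm (n * n) k ⟩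
    k * (n * n)      ∎)

  module _ (a X z : ℕ) where
    open GrowingGap a X z

    growing-gap-convex : 2 * sixP b < sixP a + sixP c
    growing-gap-convex = *-cancelˡ-< 2 (2 * sixP b) (sixP a + sixP c)
      (subst (2 * (2 * sixP b) <_) (sym (growing-balance a X z))
        (m<m+n _ {12 * u * x * y + z * N} z<s))

  module _ (a Y D : ℕ) where
    open ShrinkingGap a Y D

    ¬IsSquare-W : ¬ IsSquare W
    ¬IsSquare-W = ¬IsSquare-between (m<n+m (m * m) {R} z<s)
      (subst (W <_) (sym (square-above-W a Y D)) (m<m+n W {4 * d ²} z<s))

    module _ (balanced : sixP a + sixP c ≡ 2 * sixP b) where

      dN≡12uxy : d * N ≡ 12 * u * x * y
      dN≡12uxy = +-cancelˡ-≡ (2 * (2 * sixP b)) _ _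
        (trans (cong (λ t → 2 * t + d * N) (sym balanced)) (shrinking-balance a Y D))

      [2u]²An≡[yd]²W+[2u]²Am : (2 * u) ² * An ≡ (y * d) ² * W + (2 * u) ² * Am
      [2u]²An≡[yd]²W+[2u]²Am = begin
        (2 * u) ² * An                  ≡⟨ scaled-An a Y D ⟩
        (y * (12 * u * x * y)) ²        ≡⟨ cong (λ t → (y * t) ²) dN≡12uxy ⟨
        (y * (d * N)) ²                 ≡⟨ scaled-dN a Y D ⟩
        (y * d) ² * W + (2 * u) ² * Am  ∎

      Am<An : Am < An
      Am<An = *-cancelˡ-< ((2 * u) ²) Am An
        (subst ((2 * u) ² * Am <_) (sym [2u]²An≡[yd]²W+[2u]²Am)
          (m<n+m _ {(y * d) ² * W} z<s))

      [2u]²[An∸Am]≡[yd]²W : (2 * u) ² * (An ∸ Am) ≡ (y * d) ² * W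
      [2u]²[An∸Am]≡[yd]²W = begin
        (2 * u) ² * (An ∸ Am)
          ≡⟨ *-distribˡ-∸ ((2 * u) ²) An Am ⟩
        (2 * u) ² * An ∸ (2 * u) ² * Am
          ≡⟨ cong (_∸ (2 * u) ² * Am) [2u]²An≡[yd]²W+[2u]²Am ⟩
        (y * d) ² * W + (2 * u) ² * Am ∸ (2 * u) ² * Am
          ≡⟨ m+n∸n≡m ((y * d) ² * W) ((2 * u) ² * Am) ⟩
        (y * d) ² * W
          ∎

      ¬IsSquare-An∸Am : ¬ IsSquare (An ∸ Am)
      ¬IsSquare-An∸Am (w , w²≡An∸Am) =
        ¬IsSquare-W (IsSquare-cancelˡ (y * d) W (2 * u * w , (begin
          2 * u * w * (2 * u * w)  ≡⟨ interchange (2 * u) w (2 * u) w ⟩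
          (2 * u) ² * (w * w)      ≡⟨ cong ((2 * u) ² *_) w²≡An∸Am ⟩
          (2 * u) ² * (An ∸ Am)    ≡⟨ [2u]²[An∸Am]≡[yd]²W ⟩
          (y * d) ² * W            ∎)))

open Naturals using
  ( sixP; module ShrinkingGap; sumSquares; sumSquares*6≡sixP
  ; sumSquares-balanced⇒sixP-balanced; m<n⇒∃[o]m+suc[o]≡n; IsSquare; growing-gap-convex
  ; Am<An; ¬IsSquare-An∸Am )

import Data.Nat.Base as ℕ
import Data.Nat.Properties as ℕ
open import Data.Nat.DivMod using (m*n/n≡m)
open import Data.Integer.Base
  using (ℤ; _+_; _-_; _*_; _^_; +_; -[1+_]; _<_; +<+; ∣_∣; _/ℕ_)
open import Data.Integer.Properties using (pos-*; abs-*; +-injective; [+m]-[+n]≡m⊖n; ⊖-≥)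
open import Data.Integer.Solver using (module +-*-Solver)

A : ℤ → ℤ → ℤ → ℤ
A a b c = + 3 * (b - c) ^ 2 * (+ 12 * (b - a) ^ 2 * (c - b) ^ 2 - (a - + 2 * b + c) ^ 4)

PositiveNonSquare : ℤ → Set
PositiveNonSquare i = (+ 0 < i) × ¬ (∃ λ (k : ℤ) → k * k ≡ i)

positive-nonsquare : ∀ {i n} → i ≡ + n → 0 ℕ.< n → ¬ IsSquare n → PositiveNonSquare i
positive-nonsquare refl 0<n ¬□n = +<+ 0<n , λ { (k , k²≡n) →
  ¬□n (∣ k ∣ , trans (sym (abs-* k k)) (cong ∣_∣ k²≡n)) }

pos-sixP : ∀ n → + sixP n ≡ + n * (+ n + + 1) * (+ 2 * + n + + 1)
pos-sixP n = trans (pos-* (n ℕ.* (n ℕ.+ 1)) (2 ℕ.* n ℕ.+ 1))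
                   (cong₂ _*_ (pos-* n (n ℕ.+ 1)) (cong (_+ + 1) (pos-* 2 n)))

P-sumSquares : ∀ n → P (+ n) ≡ + sumSquares n
P-sumSquares n = begin
  P (+ n)                       ≡⟨ cong (_/ℕ 6) (pos-sixP n) ⟨
  + (sixP n ℕ./ 6)              ≡⟨ cong (λ t → + (t ℕ./ 6)) (sumSquares*6≡sixP n) ⟨
  + (sumSquares n ℕ.* 6 ℕ./ 6)  ≡⟨ cong +_ (m*n/n≡m (sumSquares n) 6) ⟩
  + sumSquares n                ∎

P-balanced⇒sixP-balanced : ∀ a b c → P (+ a) + P (+ c) ≡ + 2 * P (+ b) →
                           sixP a ℕ.+ sixP c ≡ 2 ℕ.* sixP b
P-balanced⇒sixP-balanced a b c balanced = sumSquares-balanced⇒sixP-balanced a b c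
  (+-injective (begin
    + sumSquares a + + sumSquares c  ≡⟨ cong₂ _+_ (P-sumSquares a) (P-sumSquares c) ⟨
    P (+ a) + P (+ c)                ≡⟨ balanced ⟩
    + 2 * P (+ b)                    ≡⟨ cong (+ 2 *_) (P-sumSquares b) ⟩
    + 2 * + sumSquares b             ≡⟨ pos-* 2 (sumSquares b) ⟨
    + (2 ℕ.* sumSquares b)           ∎))

A-in-gaps : ∀ a y d → A a (a + (y + d)) (a + (y + d) + y)
                    ≡ + 36 * ((y + d) * y * y * ((y + d) * y * y))
                      - + 3 * (y * d * d * (y * d * d))
A-in-gaps = solve 3 (λ a y d →
    Aₛ a (a :+ (y :+ d)) (a :+ (y :+ d) :+ y)
      := con (+ 36) :* ((y :+ d) :* y :* y :* ((y :+ d) :* y :* y))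
         :- con (+ 3) :* (y :* d :* d :* (y :* d :* d))) refl
  where
  open +-*-Solver
  Aₛ : ∀ {n} → Polynomial n → Polynomial n → Polynomial n → Polynomial n
  Aₛ a b c = con (+ 3) :* (b :- c) :^ 2
             :* (con (+ 12) :* (b :- a) :^ 2 :* (c :- b) :^ 2 :- (a :- con (+ 2) :* b :+ c) :^ 4)

pos-*³ : ∀ l m n → + (l ℕ.* m ℕ.* n) ≡ + l * + m * + n
pos-*³ l m n = trans (pos-* (l ℕ.* m) n) (cong (_* + n) (pos-* l m))

pos-scaled-square : ∀ k m {i} → + m ≡ i → + (k ℕ.* (m ℕ.* m)) ≡ + k * (i * i)
pos-scaled-square k m refl = trans (pos-* k (m ℕ.* m)) (cong (+ k *_) (pos-* m m))

module _ (a Y D : ℕ) where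
  open ShrinkingGap a Y D

  A≡An-Am : A (+ a) (+ b) (+ c) ≡ + An - + Am
  A≡An-Am = trans (A-in-gaps (+ a) (+ y) (+ d))
    (sym (cong₂ _-_ (pos-scaled-square 36 (x ℕ.* y ℕ.* y) (pos-*³ x y y))
                    (pos-scaled-square 3 (y ℕ.* d ℕ.* d) (pos-*³ y d d))))

  shrinking-gap⇒PositiveNonSquare : sixP a ℕ.+ sixP c ≡ 2 ℕ.* sixP b →
                                    PositiveNonSquare (A (+ a) (+ b) (+ c))
  shrinking-gap⇒PositiveNonSquare balanced =
    positive-nonsquare A≡An∸Am (ℕ.m<n⇒0<n∸m Am<An′) (¬IsSquare-An∸Am a Y D balanced)
    where
    Am<An′ : Am ℕ.< An
    Am<An′ = Am<An a Y D balanced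
    A≡An∸Am : A (+ a) (+ b) (+ c) ≡ + (An ℕ.∸ Am)
    A≡An∸Am = trans A≡An-Am (trans ([+m]-[+n]≡m⊖n An Am) (⊖-≥ (ℕ.<⇒≤ Am<An′)))

balanced-gaps⇒PositiveNonSquare :
  ∀ a X Y → let b = a ℕ.+ ℕ.suc X ; c = b ℕ.+ ℕ.suc Y in
  sixP a ℕ.+ sixP c ≡ 2 ℕ.* sixP b → PositiveNonSquare (A (+ a) (+ b) (+ c))
balanced-gaps⇒PositiveNonSquare a X Y balanced with ℕ.≤-<-connex (ℕ.suc X) (ℕ.suc Y)
... | inj₁ x≤y with ℕ.m≤n⇒∃[o]m+o≡n x≤y
...   | z , refl = ⊥-elim (ℕ.<-irrefl (sym balanced) (growing-gap-convex a X z))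
balanced-gaps⇒PositiveNonSquare a X Y balanced | inj₂ y<x with m<n⇒∃[o]m+suc[o]≡n y<x
...   | D , refl = shrinking-gap⇒PositiveNonSquare a Y D balanced

corollary2p3 : (a b c : ℤ) → + 0 < a + + 1 → a + + 1 < b → b < c →
    P a + P c ≡ + 2 * P b →
    (+ 0 < + 3 * (b - c) ^ 2 * (+ 12 * (b - a) ^ 2 * (c - b) ^ 2 - (a - + 2 * b + c) ^ 4))
    × ¬ (∃ λ (k : ℤ) → k * k ≡ + 3 * (b - c) ^ 2 * (+ 12 * (b - a) ^ 2 * (c - b) ^ 2 - (a - + 2 * b + c) ^ 4))
corollary2p3 -[1+ 0 ]       _        _        (+<+ ()) _ _ _
corollary2p3 -[1+ ℕ.suc _ ] _        _        ()       _ _ _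
corollary2p3 (+ _)          -[1+ _ ] _        _        () _ _
corollary2p3 (+ _)          (+ _)    -[1+ _ ] _        _  () _
corollary2p3 (+ a)          (+ b)    (+ c)    _ (+<+ a+1<b) (+<+ b<c) balanced
  with P-balanced⇒sixP-balanced a b c balanced
     | m<n⇒∃[o]m+suc[o]≡n (ℕ.m+n≤o⇒m≤o (ℕ.suc a) a+1<b)
     | m<n⇒∃[o]m+suc[o]≡n b<c
... | balancedℕ | X , refl | Y , refl = balanced-gaps⇒PositiveNonSquare a X Y balancedℕ
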